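{- $\forall\mathrm{WMSO}\not\leq\mathrm{MSO}$ and $\forall\mathrm{MSO}\not\leq\mathrm{WMSO}$.
   Context: $\mathrm{MSO}$ is monadic second-order logic (quantification over subsets of the domain). $\mathrm{WMSO}$ (weak MSO) has the same syntax but monadic second-order quantifiers range over finite subsets of the domain. $\forall\mathrm{MSO}$ (resp. $\forall\mathrm{WMSO}$) consists of sentences of the form $\forall X_1\cdots\forall X_k\,\psi$ with $X_i$ monadic relation variables and $\psi$ first-order, interpreted with MSO (resp. WMSO) semantics. For fragments $\mathcal{L},\mathcal{L}'$ of second-order logic, $\mathcal{L}\leq\mathcal{L}'$ means: for every vocabulary $\sigma$, every class of $\sigma$-structures definable by a $\sigma$-sentence of $\mathcal{L}$ is also definable by a $\sigma$-sentence of $\mathcal{L}'$. -}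

module Defs where

open import Level using (0ℓ)
open import Data.Nat using (ℕ; suc)
open import Data.Fin using (Fin)
import Data.Fin as Fin
open import Data.Bool using (Bool; true)
open import Data.List using (List; length; lookup)
open import Data.List.Membership.Propositional using (_∈_)
open import Data.Vec using (Vec)
import Data.Vec as Vec
open import Data.Product using (Σ; _×_; ∃)
open import Data.Sum using (_⊎_)
open import Data.Empty using (⊥)
open import Relation.Nullary using (¬_)
open import Relation.Binary.PropositionalEquality using (_≡_)
open import Function.Bundles using (_⇔_)

Vocabulary : Set
Vocabulary = List ℕ

RelSym : Vocabulary → Set
RelSym σ = Fin (length σ)

arity : (σ : Vocabulary) → RelSym σ → ℕ
arity σ R = lookup σ R

-- A σ-structure: a domain and an interpretation of each relation symbol
-- (relations given by characteristic functions; classically every relation is one).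
record Structure (σ : Vocabulary) : Set₁ where
  field
    Carrier : Set
    rel     : (R : RelSym σ) → Vec Carrier (arity σ R) → Bool
open Structure public

-- Formulas of monadic second-order logic over σ, with n free first-order
-- variables and m free monadic second-order variables (de Bruijn indices).
data Formula (σ : Vocabulary) : ℕ → ℕ → Set where
  atom  : ∀ {n m} (R : RelSym σ) → Vec (Fin n) (arity σ R) → Formula σ n m
  equal : ∀ {n m} → Fin n → Fin n → Formula σ n m
  mem   : ∀ {n m} → Fin n → Fin m → Formula σ n m
  neg   : ∀ {n m} → Formula σ n m → Formula σ n m
  conj  : ∀ {n m} → Formula σ n m → Formula σ n m → Formula σ n m
  disj  : ∀ {n m} → Formula σ n m → Formula σ n m → Formula σ n m
  ex₁   : ∀ {n m} → Formula σ (suc n) m → Formula σ n m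
  all₁  : ∀ {n m} → Formula σ (suc n) m → Formula σ n m
  ex₂   : ∀ {n m} → Formula σ n (suc m) → Formula σ n m
  all₂  : ∀ {n m} → Formula σ n (suc m) → Formula σ n m

Sentence : Vocabulary → Set
Sentence σ = Formula σ 0 0

data IsFO {σ : Vocabulary} : ∀ {n m} → Formula σ n m → Set where
  atom  : ∀ {n m} R xs → IsFO {n = n} {m} (atom R xs)
  equal : ∀ {n m} x y → IsFO {n = n} {m} (equal x y)
  mem   : ∀ {n m} x X → IsFO {n = n} {m} (mem x X)
  neg   : ∀ {n m} {φ : Formula σ n m} → IsFO φ → IsFO (neg φ)
  conj  : ∀ {n m} {φ ψ : Formula σ n m} → IsFO φ → IsFO ψ → IsFO (conj φ ψ)
  disj  : ∀ {n m} {φ ψ : Formula σ n m} → IsFO φ → IsFO ψ → IsFO (disj φ ψ)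
  ex₁   : ∀ {n m} {φ : Formula σ (suc n) m} → IsFO φ → IsFO (ex₁ φ)
  all₁  : ∀ {n m} {φ : Formula σ (suc n) m} → IsFO φ → IsFO (all₁ φ)

data IsUniversal {σ : Vocabulary} : ∀ {m} → Formula σ 0 m → Set where
  fo   : ∀ {m} {φ : Formula σ 0 m} → IsFO φ → IsUniversal φ
  all₂ : ∀ {m} {φ : Formula σ 0 (suc m)} → IsUniversal φ → IsUniversal (all₂ φ)

Subset : Set → Set
Subset A = A → Bool

Finite : {A : Set} → Subset A → Set
Finite {A} X = Σ (List A) λ xs → ∀ a → X a ≡ true → a ∈ xs

data Semantics : Set where
  full weak : Semantics

SetEx : Semantics → (A : Set) → (Subset A → Set) → Set
SetEx full A P = Σ (Subset A) λ X → P X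
SetEx weak A P = Σ (Subset A) λ X → Finite X × P X

SetAll : Semantics → (A : Set) → (Subset A → Set) → Set
SetAll full A P = (X : Subset A) → P X
SetAll weak A P = (X : Subset A) → Finite X → P X

extend : {A : Set} {k : ℕ} → A → (Fin k → A) → Fin (suc k) → A
extend a ρ Fin.zero    = a
extend a ρ (Fin.suc i) = ρ i

Sat : {σ : Vocabulary} (s : Semantics) (M : Structure σ) {n m : ℕ} →
      (Fin n → Carrier M) → (Fin m → Subset (Carrier M)) → Formula σ n m → Set
Sat s M ρ η (atom R xs) = rel M R (Vec.map ρ xs) ≡ true
Sat s M ρ η (equal x y) = ρ x ≡ ρ y
Sat s M ρ η (mem x X)   = η X (ρ x) ≡ true
Sat s M ρ η (neg φ)     = ¬ Sat s M ρ η φ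
Sat s M ρ η (conj φ ψ)  = Sat s M ρ η φ × Sat s M ρ η ψ
Sat s M ρ η (disj φ ψ)  = Sat s M ρ η φ ⊎ Sat s M ρ η ψ
Sat s M ρ η (ex₁ φ)     = Σ (Carrier M) λ a → Sat s M (extend a ρ) η φ
Sat s M ρ η (all₁ φ)    = (a : Carrier M) → Sat s M (extend a ρ) η φ
Sat s M ρ η (ex₂ φ)     = SetEx s (Carrier M) λ X → Sat s M ρ (extend X η) φ
Sat s M ρ η (all₂ φ)    = SetAll s (Carrier M) λ X → Sat s M ρ (extend X η) φ

noVars : {A : Set} → Fin 0 → A
noVars ()

Models : {σ : Vocabulary} → Semantics → Structure σ → Sentence σ → Set
Models s M φ = Sat s M noVars noVars φ

record Logic : Set₁ where
  field
    InFragment : {σ : Vocabulary} → Sentence σ → Set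
    semantics  : Semantics
open Logic public

MSO WMSO ∀MSO ∀WMSO : Logic
MSO   = record { InFragment = λ _ → Data.Unit.⊤ ; semantics = full }
  where import Data.Unit
WMSO  = record { InFragment = λ _ → Data.Unit.⊤ ; semantics = weak }
  where import Data.Unit
∀MSO  = record { InFragment = IsUniversal ; semantics = full }
∀WMSO = record { InFragment = IsUniversal ; semantics = weak }

_≤L_ : Logic → Logic → Set₁
L ≤L L' = (σ : Vocabulary) (φ : Sentence σ) → InFragment L φ →
          Σ (Sentence σ) λ ψ → InFragment L' ψ ×
            ((M : Structure σ) → Models (semantics L) M φ ⇔ Models (semantics L') M ψ)

-- Both separations are Ehrenfeucht–Fraïssé arguments.
--
-- With set quantifiers ranging over finite sets, ∀X ∃x x ∉ X says that the domain is infinite.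
-- In full MSO over the empty vocabulary, however, ℕ and a finite set of size 2 ^ q satisfy the
-- same sentences of quantifier rank q. The invariant of the back-and-forth game is that, for each
-- profile (which variables equal x, which set variables contain x), the two profile classes have
-- the same size up to 2 ^ k. Choosing a point removes one element from a class. Choosing a set
-- splits every class in two, and since corresponding classes agree in size up to 2 ^ (k + 1),
-- the class on the other side can be split into parts agreeing in size up to 2 ^ k.
--
-- In a grid R × C, with the relations "same row" and "same column", the universal MSO sentence
-- ∀X ¬ θ(X), where θ(X) says that X is the graph of a surjection from rows onto columns, holds
-- for ℕ × (ℕ → Bool) by Cantor's theorem and fails for ℕ × ℕ. In weak MSO all grids with
-- infinitely many rows and columns agree: finite partial bijections between the rows and between
-- the columns, inside whose image all the finite sets lie, form a back-and-forth system, because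
-- fresh rows and columns are always available.

module Submission where

open import Defs
open import Level using (0ℓ)
open import Axiom.ExcludedMiddle using (ExcludedMiddle)
open import Data.Bool using (Bool; true; false; not)
open import Data.Vec using (Vec; []; _∷_)
open import Data.Vec.Properties using (lookup∘tabulate)
open import Data.Bool.Properties using (not-involutive; ¬-not; not-¬) renaming (_≟_ to _≟ᵇ_)
open import Data.Empty using (⊥-elim)
open import Data.Fin using (Fin; zero; suc)
open import Data.Fin.Properties using (injective⇒≤)
import Data.List as List
open import Data.List using (List; []; _∷_; length; lookup; filter; take; _++_; upTo; allFin)
open import Data.List.Properties using (length-++; length-take; length-upTo; length-tabulate)
open import Data.List.Membership.Propositional using (_∈_; _∉_)
open import Data.List.Membership.Propositional.Properties using (∈-lookup; ∈-allFin; ∈-map⁺; ∈-map⁻; ∈-cartesianProduct⁺)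
open import Data.List.Relation.Unary.All as All using (All; []; _∷_)
import Data.List.Relation.Unary.All.Properties as Allₚ
open import Data.List.Relation.Unary.AllPairs using ([]; _∷_)
open import Data.List.Relation.Unary.Any using (here; there; index)
open import Data.List.Relation.Unary.Any.Properties using (lookup-index)
open import Data.List.Relation.Binary.Subset.Propositional using () renaming (_⊆_ to _⊆ˡ_)
open import Data.List.Relation.Unary.Unique.Propositional using (Unique)
import Data.List.Relation.Unary.Unique.Propositional.Properties as Uniqueₚ
open import Data.Nat using (ℕ; zero; suc; _+_; _^_; _≤_; _⊔_; z≤n; s≤s; _≤?_)
open import Data.Nat.Properties hiding (_≟_)
open import Data.Product using (Σ; Σ-syntax; ∃; _×_; _,_; proj₁; proj₂; swap)
open import Data.Product.Properties using (×-≡,≡→≡; ×-≡,≡↔≡)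
open import Data.Product.Function.NonDependent.Propositional using (_×-⇔_)
open import Data.Sum using (_⊎_; inj₁; inj₂; [_,_])
open import Data.Sum.Function.Propositional using (_⊎-⇔_)
open import Data.Unit using (⊤; tt)
open import Function using (_∘_; id)
open import Data.Nat.ListAction using (sum)
import Data.Vec as Vec
open import Function.Bundles using (_⇔_; mk⇔; Equivalence)
import Function.Properties.Equivalence as ⇔
open import Function.Properties.Inverse using (↔⇒⇔)
open import Function.Related.TypeIsomorphisms using (¬-cong-⇔)
open import Relation.Nullary using (¬_; Dec; yes; no; does; contradiction)
open import Relation.Nullary.Decidable using (dec-true; dec-false)
open import Relation.Unary using (Pred; _∩_; _⊆_; _≐_; U)
open import Relation.Unary.Properties using (≐-sym)
open import Relation.Binary.PropositionalEquality hiding ([_])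

open Equivalence using (to; from)

private
  variable
    A B : Set
    i m n T : ℕ

infix 8 _⁻¹_

_⁻¹_ : {C : Set} → (A → C) → C → Pred A 0ℓ
(f ⁻¹ c) x = f x ≡ c

does⇔ : {P : Set} (d : Dec P) → (does d ≡ true) ⇔ P
does⇔ (yes p) = mk⇔ (λ _ → p) (λ _ → refl)
does⇔ (no ¬p) = mk⇔ (λ ()) (λ p → ⊥-elim (¬p p))

≡-true⇔ : {x y : Bool} → x ≡ y → (x ≡ true) ⇔ (y ≡ true)
≡-true⇔ x≡y = mk⇔ (trans (sym x≡y)) (trans x≡y)

true⇔true⇒≡ : {x y : Bool} → (x ≡ true) ⇔ (y ≡ true) → x ≡ y
true⇔true⇒≡ {true}  x⇔y         = sym (to x⇔y refl)
true⇔true⇒≡ {false} {true}  x⇔y = from x⇔y refl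
true⇔true⇒≡ {false} {false} _   = refl

Infinite : Set → Set
Infinite A = (xs : List A) → ∃ λ a → a ∉ xs

∈⇒≤sum : ∀ {x xs} → x ∈ xs → x ≤ sum xs
∈⇒≤sum {xs = y ∷ xs} (here refl) = m≤m+n y (sum xs)
∈⇒≤sum {xs = y ∷ xs} (there x∈xs) = ≤-trans (∈⇒≤sum x∈xs) (m≤n+m (sum xs) y)

infinite-ℕ : Infinite ℕ
infinite-ℕ xs = suc (sum xs) , 1+n≰n ∘ ∈⇒≤sum

diagonal : (ℕ → ℕ → Bool) → ℕ → Bool
diagonal f k = not (f k k)

diagonal-≢ : ∀ f n → f n ≢ diagonal f
diagonal-≢ f n fn≡d = not-¬ refl (cong (λ g → g n) fn≡d)

enumerate : List (ℕ → Bool) → ℕ → ℕ → Bool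
enumerate []       _       = λ _ → false
enumerate (g ∷ gs) zero    = g
enumerate (g ∷ gs) (suc n) = enumerate gs n

enumerate-∈ : ∀ {g gs} → g ∈ gs → ∃ λ n → enumerate gs n ≡ g
enumerate-∈ (here refl) = zero , refl
enumerate-∈ (there g∈gs) = let (n , eq) = enumerate-∈ g∈gs in suc n , eq

infinite-ℕ→Bool : Infinite (ℕ → Bool)
infinite-ℕ→Bool gs = diagonal (enumerate gs) , λ d∈gs →
  let (n , eq) = enumerate-∈ d∈gs in diagonal-≢ (enumerate gs) n eq

-- Counting

AtLeast : ℕ → Pred A 0ℓ → Set
AtLeast {A} n P = Σ[ xs ∈ List A ] Unique xs × All P xs × n ≤ length xs

atLeast-≤ : {P : Pred A 0ℓ} → m ≤ n → AtLeast n P → AtLeast m P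
atLeast-≤ m≤n (xs , u , ps , n≤) = xs , u , ps , ≤-trans m≤n n≤

atLeast-⊆ : {P Q : Pred A 0ℓ} → P ⊆ Q → AtLeast n P → AtLeast n Q
atLeast-⊆ P⊆Q (xs , u , ps , n≤) = xs , u , All.map P⊆Q ps , n≤

atLeast-zero : {P : Pred A 0ℓ} → AtLeast 0 P
atLeast-zero = [] , [] , [] , z≤n

atLeast-one : {P : Pred A 0ℓ} {x : A} → P x → AtLeast 1 P
atLeast-one px = _ ∷ [] , [] ∷ [] , px ∷ [] , ≤-refl

module _ {P : Pred A 0ℓ} (X : A → Bool) where

  atLeast-+ : AtLeast m (P ∩ X ⁻¹ true) → AtLeast n (P ∩ X ⁻¹ false) → AtLeast (m + n) P
  atLeast-+ {m} {n} (xs , u , ps , m≤) (ys , v , qs , n≤) =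
    xs ++ ys , Uniqueₚ.++⁺ u v disjoint , Allₚ.++⁺ (All.map proj₁ ps) (All.map proj₁ qs) ,
    subst (m + n ≤_) (sym (length-++ xs)) (+-mono-≤ m≤ n≤)
    where
    disjoint : ∀ {x} → ¬ (x ∈ xs × x ∈ ys)
    disjoint (x∈xs , x∈ys) with All.lookup ps x∈xs | All.lookup qs x∈ys
    ... | _ , Xx≡true | _ , Xx≡false = contradiction (trans (sym Xx≡true) Xx≡false) λ ()

  private
    part : Bool → List A → List A
    part β = filter (λ x → X x ≟ᵇ β)

    length-parts : ∀ xs → length (part true xs) + length (part false xs) ≡ length xs
    length-parts [] = refl
    length-parts (x ∷ xs) with X x
    ... | true = cong suc (length-parts xs)
    ... | false = trans (+-suc _ _) (cong suc (length-parts xs))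

    all-part : ∀ {xs} β → All P xs → All (P ∩ X ⁻¹ β) (part β xs)
    all-part {xs} β ps = All.zip (Allₚ.filter⁺ _ ps , Allₚ.all-filter _ xs)

  atLeast-split : AtLeast (m + n) P → AtLeast (suc m) (P ∩ X ⁻¹ true) ⊎ AtLeast n (P ∩ X ⁻¹ false)
  atLeast-split {m} {n} (xs , u , ps , m+n≤) with suc m ≤? length (part true xs)
  ... | yes m<ins = inj₁ (part true xs , Uniqueₚ.filter⁺ _ u , all-part true ps , m<ins)
  ... | no m≮ins = inj₂ (part false xs , Uniqueₚ.filter⁺ _ u , all-part false ps , n≤outs)
    where
    n≤outs : n ≤ length (part false xs)
    n≤outs = +-cancelˡ-≤ m n _ (begin
      m + n                                         ≤⟨ m+n≤ ⟩
      length xs                                     ≡⟨ length-parts xs ⟨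
      length (part true xs) + length (part false xs) ≤⟨ +-monoˡ-≤ _ (≮⇒≥ m≮ins) ⟩
      m + length (part false xs)                    ∎)
      where open ≤-Reasoning

unique-lookup-injective : ∀ {xs : List A} → Unique xs → ∀ {i j} → lookup xs i ≡ lookup xs j → i ≡ j
unique-lookup-injective (x∉ ∷ u) {zero} {zero} _ = refl
unique-lookup-injective (x∉ ∷ u) {zero} {suc j} eq = contradiction eq (All.lookup x∉ (∈-lookup j))
unique-lookup-injective (x∉ ∷ u) {suc i} {zero} eq = contradiction (sym eq) (All.lookup x∉ (∈-lookup i))
unique-lookup-injective (x∉ ∷ u) {suc i} {suc j} eq = cong suc (unique-lookup-injective u eq)

unique⊆⇒length≤ : ∀ {xs ys : List A} → Unique xs → (∀ {x} → x ∈ xs → x ∈ ys) → length xs ≤ length ys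
unique⊆⇒length≤ {xs = xs} {ys} u xs⊆ys = injective⇒≤ position-injective
  where
  position : Fin (length xs) → Fin (length ys)
  position i = index (xs⊆ys (∈-lookup i))
  position-injective : ∀ {i j} → position i ≡ position j → i ≡ j
  position-injective {i} {j} eq = unique-lookup-injective u (begin
    lookup xs i            ≡⟨ lookup-index (xs⊆ys (∈-lookup i)) ⟩
    lookup ys (position i) ≡⟨ cong (lookup ys) eq ⟩
    lookup ys (position j) ≡⟨ lookup-index (xs⊆ys (∈-lookup j)) ⟨
    lookup xs j            ∎)
    where open ≡-Reasoning

atLeast-∈⇒≤ : {ys : List A} → AtLeast n (_∈ ys) → n ≤ length ys
atLeast-∈⇒≤ (xs , u , xs⊆ys , n≤) = ≤-trans n≤ (unique⊆⇒length≤ u (All.lookup xs⊆ys))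

atLeast⇒exactly : {P : Pred A 0ℓ} → AtLeast n P → Σ[ xs ∈ List A ] Unique xs × All P xs × length xs ≡ n
atLeast⇒exactly {n = n} (xs , u , ps , n≤) =
  take n xs , Uniqueₚ.take⁺ n u , Allₚ.take⁺ n ps , trans (length-take n xs) (m≤n⇒m⊓n≡m n≤)

infix 4 _≈[_]_

_≈[_]_ : Pred A 0ℓ → ℕ → Pred B 0ℓ → Set
P ≈[ T ] Q = ∀ {i} → i ≤ T → AtLeast i P ⇔ AtLeast i Q

module _ {P : Pred A 0ℓ} {Q : Pred B 0ℓ} where

  ≈-sym : P ≈[ T ] Q → Q ≈[ T ] P
  ≈-sym P≈Q i≤T = ⇔.sym (P≈Q i≤T)

  ≈-≤ : m ≤ n → P ≈[ n ] Q → P ≈[ m ] Q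
  ≈-≤ m≤n P≈Q i≤m = P≈Q (≤-trans i≤m m≤n)

  ≈-resp : {P′ : Pred A 0ℓ} {Q′ : Pred B 0ℓ} → P ≐ P′ → Q ≐ Q′ → P ≈[ T ] Q → P′ ≈[ T ] Q′
  ≈-resp (P⊆P′ , P′⊆P) (Q⊆Q′ , Q′⊆Q) P≈Q i≤T =
    mk⇔ (atLeast-⊆ Q⊆Q′ ∘ to (P≈Q i≤T) ∘ atLeast-⊆ P′⊆P) (atLeast-⊆ P⊆P′ ∘ from (P≈Q i≤T) ∘ atLeast-⊆ Q′⊆Q)

∩-not⁻¹ : {P : Pred A 0ℓ} {X : A → Bool} {β : Bool} → (P ∩ (not ∘ X) ⁻¹ β) ≐ (P ∩ X ⁻¹ not β)
∩-not⁻¹ = (λ (p , e) → p , trans (sym (not-involutive _)) (cong not e))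
        , (λ (p , e) → p , trans (cong not e) (not-involutive _))

CappedCount : ℕ → Pred A 0ℓ → ℕ → Set
CappedCount T P c = c ≤ T × (∀ {i} → i ≤ T → AtLeast i P ⇔ i ≤ c)

cappedCount-≈ : {P : Pred A 0ℓ} {Q : Pred B 0ℓ} {c : ℕ} → CappedCount T P c → CappedCount T Q c → P ≈[ T ] Q
cappedCount-≈ (_ , P≥) (_ , Q≥) i≤T = ⇔.trans (P≥ i≤T) (⇔.sym (Q≥ i≤T))

cappedCount-resp : {P Q : Pred A 0ℓ} {c : ℕ} → P ≐ Q → CappedCount T P c → CappedCount T Q c
cappedCount-resp (P⊆Q , Q⊆P) (c≤T , P≥) = c≤T , λ i≤T → ⇔.trans (mk⇔ (atLeast-⊆ Q⊆P) (atLeast-⊆ P⊆Q)) (P≥ i≤T)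

U-ℕ≈U-Fin : ∀ N → U {A = ℕ} ≈[ N ] U {A = Fin N}
U-ℕ≈U-Fin N {i} i≤N = mk⇔
  (λ _ → allFin N , Uniqueₚ.allFin⁺ N , All.universal-U _ , subst (i ≤_) (sym (length-tabulate id)) i≤N)
  (λ _ → upTo i , Uniqueₚ.upTo⁺ i , All.universal-U _ , ≤-reflexive (sym (length-upTo i)))

-- Back-and-forth systems

quantifierRank : ∀ {σ n m} → Formula σ n m → ℕ
quantifierRank (atom R xs) = 0
quantifierRank (equal x y) = 0
quantifierRank (mem x X)   = 0
quantifierRank (neg φ)     = quantifierRank φ
quantifierRank (conj φ ψ)  = quantifierRank φ ⊔ quantifierRank ψ
quantifierRank (disj φ ψ)  = quantifierRank φ ⊔ quantifierRank ψ
quantifierRank (ex₁ φ)     = suc (quantifierRank φ)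
quantifierRank (all₁ φ)    = suc (quantifierRank φ)
quantifierRank (ex₂ φ)     = suc (quantifierRank φ)
quantifierRank (all₂ φ)    = suc (quantifierRank φ)

Admissible : Semantics → Subset A → Set
Admissible full X = ⊤
Admissible weak X = Finite X

AdmissibleSubset : Semantics → Set → Set
AdmissibleSubset s A = Σ (Subset A) (Admissible s)

setEx⇔ : ∀ s {P : Subset A → Set} → SetEx s A P ⇔ Σ (AdmissibleSubset s A) (P ∘ proj₁)
setEx⇔ full = mk⇔ (λ (X , p) → (X , tt) , p) (λ ((X , _) , p) → X , p)
setEx⇔ weak = mk⇔ (λ (X , fin , p) → (X , fin) , p) (λ ((X , fin) , p) → X , fin , p)

setAll⇔ : ∀ s {P : Subset A → Set} → SetAll s A P ⇔ ((X : AdmissibleSubset s A) → P (proj₁ X))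
setAll⇔ full = mk⇔ (λ p (X , _) → p X) (λ p X → p (X , tt))
setAll⇔ weak = mk⇔ (λ p (X , fin) → p X fin) (λ p X fin → p (X , fin))

module _ {R : A → B → Set} (forth : ∀ a → ∃ (R a)) (back : ∀ b → ∃ λ a → R a b)
         {P : A → Set} {Q : B → Set} (P⇔Q : ∀ {a b} → R a b → P a ⇔ Q b) where

  Σ-⇔ : Σ A P ⇔ Σ B Q
  Σ-⇔ = mk⇔ (λ (a , p) → let (b , r) = forth a in b , to (P⇔Q r) p)
            (λ (b , q) → let (a , r) = back b in a , from (P⇔Q r) q)

  Π-⇔ : ((a : A) → P a) ⇔ ((b : B) → Q b)
  Π-⇔ = mk⇔ (λ p b → let (a , r) = back b in to (P⇔Q r) (p a))
            (λ q a → let (b , r) = forth a in from (P⇔Q r) (q b))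

record BackAndForth (s : Semantics) {σ : Vocabulary} (M N : Structure σ) : Set₁ where
  field
    Related : ℕ → ∀ {n m} → (Fin n → Carrier M) → (Fin m → Subset (Carrier M)) →
              (Fin n → Carrier N) → (Fin m → Subset (Carrier N)) → Set
    related⇒atom  : ∀ {k n m ρ η ρ′ η′} → Related k {n} {m} ρ η ρ′ η′ →
                    ∀ R xs → (rel M R (Vec.map ρ xs) ≡ true) ⇔ (rel N R (Vec.map ρ′ xs) ≡ true)
    related⇒equal : ∀ {k n m ρ η ρ′ η′} → Related k {n} {m} ρ η ρ′ η′ → ∀ i j → (ρ i ≡ ρ j) ⇔ (ρ′ i ≡ ρ′ j)
    related⇒mem   : ∀ {k n m ρ η ρ′ η′} → Related k {n} {m} ρ η ρ′ η′ →
                    ∀ i X → (η X (ρ i) ≡ true) ⇔ (η′ X (ρ′ i) ≡ true)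
    forth₁ : ∀ {k n m ρ η ρ′ η′} → Related (suc k) {n} {m} ρ η ρ′ η′ →
             ∀ a → ∃ λ b → Related k (extend a ρ) η (extend b ρ′) η′
    back₁  : ∀ {k n m ρ η ρ′ η′} → Related (suc k) {n} {m} ρ η ρ′ η′ →
             ∀ b → ∃ λ a → Related k (extend a ρ) η (extend b ρ′) η′
    forth₂ : ∀ {k n m ρ η ρ′ η′} → Related (suc k) {n} {m} ρ η ρ′ η′ →
             ∀ (X : AdmissibleSubset s (Carrier M)) → ∃ λ (Y : AdmissibleSubset s (Carrier N)) →
             Related k ρ (extend (proj₁ X) η) ρ′ (extend (proj₁ Y) η′)
    back₂  : ∀ {k n m ρ η ρ′ η′} → Related (suc k) {n} {m} ρ η ρ′ η′ →
             ∀ (Y : AdmissibleSubset s (Carrier N)) → ∃ λ (X : AdmissibleSubset s (Carrier M)) →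
             Related k ρ (extend (proj₁ X) η) ρ′ (extend (proj₁ Y) η′)

  sat-transfer : ∀ {n m} (φ : Formula σ n m) {k ρ η ρ′ η′} → quantifierRank φ ≤ k →
                 Related k ρ η ρ′ η′ → Sat s M ρ η φ ⇔ Sat s N ρ′ η′ φ
  sat-transfer (atom R xs) _ r = related⇒atom r R xs
  sat-transfer (equal i j) _ r = related⇒equal r i j
  sat-transfer (mem i X)   _ r = related⇒mem r i X
  sat-transfer (neg φ)     q r = ¬-cong-⇔ (sat-transfer φ q r)
  sat-transfer (conj φ ψ)  q r =
    sat-transfer φ (m⊔n≤o⇒m≤o _ _ q) r ×-⇔ sat-transfer ψ (m⊔n≤o⇒n≤o _ _ q) r
  sat-transfer (disj φ ψ)  q r =
    sat-transfer φ (m⊔n≤o⇒m≤o _ _ q) r ⊎-⇔ sat-transfer ψ (m⊔n≤o⇒n≤o _ _ q) r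
  sat-transfer (ex₁ φ)  {suc k} (s≤s q) r = Σ-⇔ (forth₁ r) (back₁ r) (sat-transfer φ q)
  sat-transfer (all₁ φ) {suc k} (s≤s q) r = Π-⇔ (forth₁ r) (back₁ r) (sat-transfer φ q)
  sat-transfer (ex₂ φ)  {suc k} (s≤s q) r =
    ⇔.trans (setEx⇔ s) (⇔.trans (Σ-⇔ (forth₂ r) (back₂ r) (sat-transfer φ q)) (⇔.sym (setEx⇔ s)))
  sat-transfer (all₂ φ) {suc k} (s≤s q) r =
    ⇔.trans (setAll⇔ s) (⇔.trans (Π-⇔ (forth₂ r) (back₂ r) (sat-transfer φ q)) (⇔.sym (setAll⇔ s)))

  models-transfer : (φ : Sentence σ) → Related (quantifierRank φ) noVars noVars noVars noVars →
                    Models s M φ ⇔ Models s N φ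
  models-transfer φ = sat-transfer φ ≤-refl

Dom : {A B : Set} → List (A × B) → Pred A 0ℓ
Dom π a = ∃ λ b → (a , b) ∈ π

Rng : {A B : Set} → List (A × B) → Pred B 0ℓ
Rng π b = ∃ λ a → (a , b) ∈ π

IsPartialBijection : {A B : Set} → List (A × B) → Set
IsPartialBijection π = ∀ {a b a′ b′} → (a , b) ∈ π → (a′ , b′) ∈ π → (a ≡ a′) ⇔ (b ≡ b′)

isPartialBijection-∷ : ∀ {π : List (A × B)} {a b} → IsPartialBijection π → ¬ Dom π a → ¬ Rng π b →
                       IsPartialBijection ((a , b) ∷ π)
isPartialBijection-∷ bij ∉dom ∉rng (here refl) (here refl)  = mk⇔ (λ _ → refl) (λ _ → refl)
isPartialBijection-∷ bij ∉dom ∉rng (here refl) (there p′∈) =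
  mk⇔ (λ { refl → ⊥-elim (∉dom (_ , p′∈)) }) (λ { refl → ⊥-elim (∉rng (_ , p′∈)) })
isPartialBijection-∷ bij ∉dom ∉rng (there p∈) (here refl)  =
  mk⇔ (λ { refl → ⊥-elim (∉dom (_ , p∈)) }) (λ { refl → ⊥-elim (∉rng (_ , p∈)) })
isPartialBijection-∷ bij ∉dom ∉rng (there p∈) (there p′∈) = bij p∈ p′∈

∈-map-swap⁻ : ∀ {π : List (A × B)} {a b} → (b , a) ∈ List.map swap π → (a , b) ∈ π
∈-map-swap⁻ p∈ with ∈-map⁻ swap p∈
... | _ , p∈π , refl = p∈π

isPartialBijection-swap : ∀ {π : List (A × B)} → IsPartialBijection π → IsPartialBijection (List.map swap π)
isPartialBijection-swap bij p∈ p′∈ = ⇔.sym (bij (∈-map-swap⁻ p∈) (∈-map-swap⁻ p′∈))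

GridVocabulary : Vocabulary
GridVocabulary = 2 ∷ 2 ∷ []

sameRow sameColumn : RelSym GridVocabulary
sameRow    = zero
sameColumn = suc zero

module _ {R₁ C₁ R₂ C₂ : Set} where

  Corresponds : List (R₁ × R₂) → List (C₁ × C₂) → R₁ × C₁ → R₂ × C₂ → Set
  Corresponds rowPairs columnPairs a b = (proj₁ a , proj₁ b) ∈ rowPairs × (proj₂ a , proj₂ b) ∈ columnPairs

  record Matching {n m} (ρ : Fin n → R₁ × C₁) (η : Fin m → Subset (R₁ × C₁))
                  (ρ′ : Fin n → R₂ × C₂) (η′ : Fin m → Subset (R₂ × C₂)) : Set where
    field
      rowPairs    : List (R₁ × R₂)
      columnPairs : List (C₁ × C₂)
      rows        : IsPartialBijection rowPairs
      columns     : IsPartialBijection columnPairs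
      points      : ∀ i → Corresponds rowPairs columnPairs (ρ i) (ρ′ i)
      sets        : ∀ X {a b} → Corresponds rowPairs columnPairs a b → η X a ≡ η′ X b
      supportˡ    : ∀ X {a} → η X a ≡ true → Dom rowPairs (proj₁ a) × Dom columnPairs (proj₂ a)
      supportʳ    : ∀ X {b} → η′ X b ≡ true → Rng rowPairs (proj₁ b) × Rng columnPairs (proj₂ b)

matching-swap : ∀ {R₁ C₁ R₂ C₂ n m} {ρ : Fin n → R₁ × C₁} {η : Fin m → Subset (R₁ × C₁)}
                {ρ′ : Fin n → R₂ × C₂} {η′ : Fin m → Subset (R₂ × C₂)} → Matching ρ η ρ′ η′ → Matching ρ′ η′ ρ η
matching-swap M = record
  { rowPairs    = List.map swap rowPairs
  ; columnPairs = List.map swap columnPairs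
  ; rows        = isPartialBijection-swap rows
  ; columns     = isPartialBijection-swap columns
  ; points      = λ i → let (r , c) = points i in ∈-map⁺ swap r , ∈-map⁺ swap c
  ; sets        = λ X (r , c) → sym (sets X (∈-map-swap⁻ r , ∈-map-swap⁻ c))
  ; supportˡ    = λ X b∈X → let ((_ , r) , (_ , c)) = supportʳ X b∈X in (_ , ∈-map⁺ swap r) , (_ , ∈-map⁺ swap c)
  ; supportʳ    = λ X a∈X → let ((_ , r) , (_ , c)) = supportˡ X a∈X in (_ , ∈-map⁺ swap r) , (_ , ∈-map⁺ swap c)
  }
  where open Matching M

open Matching

-- θ(X): X is total on rows, meets every column, and X-points in the same row are in the same column
surjectionGraph : Formula GridVocabulary 0 1
surjectionGraph =
  conj (all₁ (ex₁ (conj (mem v₀ zero) (atom sameRow (v₀ ∷ v₁ ∷ [])))))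
  (conj (all₁ (ex₁ (conj (mem v₀ zero) (atom sameColumn (v₀ ∷ v₁ ∷ [])))))
        (all₁ (all₁ (disj (neg (conj (mem v₁ zero) (conj (mem v₀ zero) (atom sameRow (v₁ ∷ v₀ ∷ [])))))
                          (atom sameColumn (v₁ ∷ v₀ ∷ []))))))
  where
  v₀ v₁ : ∀ {n} → Fin (suc (suc n))
  v₀ = zero
  v₁ = suc zero

noSurjection : Sentence GridVocabulary
noSurjection = all₂ (neg surjectionGraph)

noSurjection-universal : IsUniversal noSurjection
noSurjection-universal = all₂ (fo (neg
  (conj (all₁ (ex₁ (conj (mem _ _) (atom _ _))))
  (conj (all₁ (ex₁ (conj (mem _ _) (atom _ _))))
        (all₁ (all₁ (disj (neg (conj (mem _ _) (conj (mem _ _) (atom _ _)))) (atom _ _))))))))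

PureSet : Set → Structure []
PureSet A = record { Carrier = A ; rel = λ () }

infiniteDomain : Sentence []
infiniteDomain = all₂ (ex₁ (neg (mem zero zero)))

infiniteDomain-universal : IsUniversal infiniteDomain
infiniteDomain-universal = all₂ (fo (ex₁ (neg (mem _ _))))

infinite⇒infiniteDomain : Infinite A → Models weak (PureSet A) infiniteDomain
infinite⇒infiniteDomain infinite X (xs , X⊆xs) = let (a , a∉xs) = infinite xs in a , a∉xs ∘ X⊆xs a

finite⇒¬infiniteDomain : (xs : List A) → (∀ a → a ∈ xs) → ¬ Models weak (PureSet A) infiniteDomain
finite⇒¬infiniteDomain xs all∈xs holds = let (a , a∉) = holds (λ _ → true) (xs , λ a _ → all∈xs a) in a∉ refl

module _ (lem : ExcludedMiddle 0ℓ) where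

  _≟_ : {A : Set} → (x y : A) → Dec (x ≡ y)
  x ≟ y = lem

  cappedCount : ∀ T (P : Pred A 0ℓ) → ∃ (CappedCount T P)
  cappedCount zero P = 0 , z≤n , λ { z≤n → mk⇔ (λ _ → z≤n) (λ _ → atLeast-zero) }
  cappedCount (suc T) P with lem {AtLeast (suc T) P}
  ... | yes P≥ = suc T , ≤-refl , λ i≤ → mk⇔ (λ _ → i≤) (λ _ → atLeast-≤ i≤ P≥)
  ... | no P≱ with cappedCount T P
  ... | c , c≤T , P≥ = c , m≤n⇒m≤1+n c≤T , P≥′
    where
    P≥′ : ∀ {i} → i ≤ suc T → AtLeast i P ⇔ i ≤ c
    P≥′ {i} i≤1+T with i ≤? T
    ... | yes i≤T = P≥ i≤T
    ... | no i≰T = mk⇔ (λ h → contradiction (atLeast-≤ (≰⇒> i≰T) h) P≱)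
                        (λ i≤c → contradiction (≤-trans i≤c c≤T) i≰T)

  module _ {P : Pred A 0ℓ} {Q : Pred B 0ℓ} (P≈Q : P ≈[ T + T ] Q) where

    private
      -- Z marks a elements of Q. Since a ≤ b, whenever the unmarked count b is below T so is a,
      -- and then both counts of P are exact.
      splitAlongSmaller : (X : A → Bool) {a b : ℕ} →
                          CappedCount T (P ∩ X ⁻¹ true) a → CappedCount T (P ∩ X ⁻¹ false) b → a ≤ b →
                          Σ[ Z ∈ (B → Bool) ] ∀ β → (P ∩ X ⁻¹ β) ≈[ T ] (Q ∩ Z ⁻¹ β)
      splitAlongSmaller X {a} {b} (a≤T , P∩X≥) (b≤T , P∖X≥) a≤b
        with Q≥a+b ← to (P≈Q (+-mono-≤ a≤T b≤T)) (atLeast-+ X (from (P∩X≥ a≤T) ≤-refl) (from (P∖X≥ b≤T) ≤-refl))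
        with L , uniqueL , QL , |L|≡a ← atLeast⇒exactly (atLeast-≤ (m≤m+n a b) Q≥a+b) =
        Z , λ { true → cappedCount-≈ (a≤T , P∩X≥) (a≤T , Q∩Z≥) ; false → cappedCount-≈ (b≤T , P∖X≥) (b≤T , Q∖Z≥) }
        where
        Z : B → Bool
        Z y = does (lem {y ∈ L})

        inZ≤a : AtLeast i (Q ∩ Z ⁻¹ true) → i ≤ a
        inZ≤a h = subst (_ ≤_) |L|≡a (atLeast-∈⇒≤ (atLeast-⊆ (λ (_ , z) → to (does⇔ lem) z) h))

        Q∩Z≥a : AtLeast a (Q ∩ Z ⁻¹ true)
        Q∩Z≥a = L , uniqueL , All.zip (QL , All.tabulate (from (does⇔ lem))) , ≤-reflexive (sym |L|≡a)

        Q∖Z≥b : AtLeast b (Q ∩ Z ⁻¹ false)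
        Q∖Z≥b with atLeast-split Z Q≥a+b
        ... | inj₁ h = contradiction (inZ≤a h) 1+n≰n
        ... | inj₂ h = h

        Q∩Z≥ : ∀ {i} → i ≤ T → AtLeast i (Q ∩ Z ⁻¹ true) ⇔ i ≤ a
        Q∩Z≥ _ = mk⇔ inZ≤a (λ i≤a → atLeast-≤ i≤a Q∩Z≥a)

        Q∖Z≥ : ∀ {i} → i ≤ T → AtLeast i (Q ∩ Z ⁻¹ false) ⇔ i ≤ b
        Q∖Z≥ {i} i≤T = mk⇔ bound (λ i≤b → atLeast-≤ i≤b Q∖Z≥b)
          where
          bound : AtLeast i (Q ∩ Z ⁻¹ false) → i ≤ b
          bound h with atLeast-split X (from (P≈Q (+-mono-≤ a≤T i≤T)) (atLeast-+ Z Q∩Z≥a h))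
          ... | inj₂ h′ = to (P∖X≥ i≤T) h′
          ... | inj₁ h′ with suc a ≤? T
          ...   | yes a<T = contradiction (to (P∩X≥ a<T) h′) 1+n≰n
          ...   | no a≮T = ≤-trans i≤T (≤-trans (≮⇒≥ a≮T) a≤b)

    split : (X : A → Bool) → Σ[ Z ∈ (B → Bool) ] ∀ β → (P ∩ X ⁻¹ β) ≈[ T ] (Q ∩ Z ⁻¹ β)
    split X with cappedCount T (P ∩ X ⁻¹ true) | cappedCount T (P ∩ X ⁻¹ false)
    ... | a , countX | b , count∖X with a ≤? b
    ... | yes a≤b = splitAlongSmaller X countX count∖X a≤b
    ... | no a≰b with splitAlongSmaller (not ∘ X) (cappedCount-resp (≐-sym ∩-not⁻¹) count∖X)
                                                   (cappedCount-resp (≐-sym ∩-not⁻¹) countX) (≰⇒≥ a≰b)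
    ...   | Z , P≈Q′ = not ∘ Z , λ { true  → ≈-resp ∩-not⁻¹ (≐-sym ∩-not⁻¹) (P≈Q′ false)
                                   ; false → ≈-resp ∩-not⁻¹ (≐-sym ∩-not⁻¹) (P≈Q′ true) }

  ⁅_⁆ : A → Subset A
  ⁅ a ⁆ x = does (a ≟ x)

  module _ {P : Pred A 0ℓ} {a : A} where

    ¬atLeast-2+-⁅⁆ : ¬ AtLeast (2 + i) (P ∩ ⁅ a ⁆ ⁻¹ true)
    ¬atLeast-2+-⁅⁆ h with atLeast-∈⇒≤ {ys = a ∷ []} (atLeast-⊆ (λ (_ , e) → here (sym (to (does⇔ lem) e))) h)
    ... | s≤s ()

    atLeast-one-⁅⁆ : AtLeast 1 (P ∩ ⁅ a ⁆ ⁻¹ true) ⇔ P a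
    atLeast-one-⁅⁆ = mk⇔ (λ { (_ ∷ _ , _ , (px , e) ∷ _ , _) → subst P (sym (to (does⇔ lem) e)) px })
                         (λ pa → atLeast-one (pa , dec-true lem refl))

    atLeast-remove-⁅⁆ : P a → AtLeast (suc i) P ⇔ AtLeast i (P ∩ ⁅ a ⁆ ⁻¹ false)
    atLeast-remove-⁅⁆ pa = mk⇔ outside (atLeast-+ ⁅ a ⁆ (from atLeast-one-⁅⁆ pa))
      where
      outside : AtLeast (suc i) P → AtLeast i (P ∩ ⁅ a ⁆ ⁻¹ false)
      outside h with atLeast-split ⁅ a ⁆ {m = 1} h
      ... | inj₁ h′ = ⊥-elim (¬atLeast-2+-⁅⁆ h′)
      ... | inj₂ h′ = h′

    ∩-⁅⁆-absent : ¬ P a → P ≐ P ∩ ⁅ a ⁆ ⁻¹ false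
    ∩-⁅⁆-absent ¬pa = (λ px → px , dec-false lem λ a≡x → ¬pa (subst P (sym a≡x) px)) , proj₁

  ≈-⁅⁆ : {P : Pred A 0ℓ} {Q : Pred B 0ℓ} {a : A} {b : B} → P ≈[ suc T ] Q → (P a ⇔ Q b) →
         ∀ β → (P ∩ ⁅ a ⁆ ⁻¹ β) ≈[ T ] (Q ∩ ⁅ b ⁆ ⁻¹ β)
  ≈-⁅⁆ P≈Q Pa⇔Qb true {zero} _ = mk⇔ (λ _ → atLeast-zero) (λ _ → atLeast-zero)
  ≈-⁅⁆ P≈Q Pa⇔Qb true {suc zero} _ = ⇔.trans atLeast-one-⁅⁆ (⇔.trans Pa⇔Qb (⇔.sym atLeast-one-⁅⁆))
  ≈-⁅⁆ P≈Q Pa⇔Qb true {suc (suc i)} _ = mk⇔ (⊥-elim ∘ ¬atLeast-2+-⁅⁆) (⊥-elim ∘ ¬atLeast-2+-⁅⁆)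
  ≈-⁅⁆ {P = P} {a = a} P≈Q Pa⇔Qb false i≤T with lem {P a}
  ... | yes pa = ⇔.trans (⇔.sym (atLeast-remove-⁅⁆ pa)) (⇔.trans (P≈Q (s≤s i≤T)) (atLeast-remove-⁅⁆ (to Pa⇔Qb pa)))
  ... | no ¬pa = ≈-resp (∩-⁅⁆-absent ¬pa) (∩-⁅⁆-absent (¬pa ∘ from Pa⇔Qb)) (≈-≤ (n≤1+n _) P≈Q) i≤T

  -- MSO on pure sets

  Profile : ℕ → ℕ → Set
  Profile n m = Vec Bool n × Vec Bool m

  profile : (Fin n → A) → (Fin m → Subset A) → A → Profile n m
  profile ρ η x = Vec.tabulate (λ i → ⁅ ρ i ⁆ x) , Vec.tabulate (λ X → η X x)

  record Similar (T : ℕ) (ρ : Fin n → A) (η : Fin m → Subset A) (ρ′ : Fin n → B) (η′ : Fin m → Subset B) : Set where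
    constructor similar
    field profiles-≈ : ∀ t → profile ρ η ⁻¹ t ≈[ T ] profile ρ′ η′ ⁻¹ t

  module _ {ρ : Fin n → A} {η : Fin m → Subset A} {ρ′ : Fin n → B} {η′ : Fin m → Subset B} where

    similar-sym : Similar T ρ η ρ′ η′ → Similar T ρ′ η′ ρ η
    similar-sym (similar sim) = similar λ t → ≈-sym (sim t)

    similar-≤ : i ≤ T → Similar T ρ η ρ′ η′ → Similar i ρ η ρ′ η′
    similar-≤ i≤T (similar sim) = similar λ t → ≈-≤ i≤T (sim t)

    profile-≡⇒bits : ∀ {x y} → profile ρ η x ≡ profile ρ′ η′ y →
                     (∀ i → ⁅ ρ i ⁆ x ≡ ⁅ ρ′ i ⁆ y) × (∀ X → η X x ≡ η′ X y)
    profile-≡⇒bits {x} {y} same = (λ i → begin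
        ⁅ ρ i ⁆ x                               ≡⟨ lookup∘tabulate _ i ⟨
        Vec.lookup (proj₁ (profile ρ η x)) i    ≡⟨ cong (λ t → Vec.lookup (proj₁ t) i) same ⟩
        Vec.lookup (proj₁ (profile ρ′ η′ y)) i  ≡⟨ lookup∘tabulate _ i ⟩
        ⁅ ρ′ i ⁆ y                              ∎)
      , (λ X → begin
        η X x                                   ≡⟨ lookup∘tabulate _ X ⟨
        Vec.lookup (proj₂ (profile ρ η x)) X    ≡⟨ cong (λ t → Vec.lookup (proj₂ t) X) same ⟩
        Vec.lookup (proj₂ (profile ρ′ η′ y)) X  ≡⟨ lookup∘tabulate _ X ⟩
        η′ X y                                  ∎)
      where open ≡-Reasoning

    -- the profile of ρ i has a 1 at position i, so an element of that profile must be ρ′ i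
    similar⇒profile-≡ : 1 ≤ T → Similar T ρ η ρ′ η′ → ∀ i → profile ρ η (ρ i) ≡ profile ρ′ η′ (ρ′ i)
    similar⇒profile-≡ 1≤T (similar sim) i with to (sim (profile ρ η (ρ i)) 1≤T) (atLeast-one refl)
    ... | y ∷ _ , _ , y-profile ∷ _ , _ = sym (trans (cong (profile ρ′ η′) ρ′i≡y) y-profile)
      where
      ρ′i≡y : ρ′ i ≡ y
      ρ′i≡y = to (does⇔ lem) (trans (sym (proj₁ (profile-≡⇒bits (sym y-profile)) i)) (dec-true lem refl))

    similar⇒equal : 1 ≤ T → Similar T ρ η ρ′ η′ → ∀ i j → (ρ i ≡ ρ j) ⇔ (ρ′ i ≡ ρ′ j)
    similar⇒equal 1≤T sim i j = ⇔.trans (⇔.sym (does⇔ lem))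
      (⇔.trans (≡-true⇔ (proj₁ (profile-≡⇒bits (similar⇒profile-≡ 1≤T sim j)) i)) (does⇔ lem))

    similar⇒mem : 1 ≤ T → Similar T ρ η ρ′ η′ → ∀ i X → (η X (ρ i) ≡ true) ⇔ (η′ X (ρ′ i) ≡ true)
    similar⇒mem 1≤T sim i X = ≡-true⇔ (proj₂ (profile-≡⇒bits (similar⇒profile-≡ 1≤T sim i)) X)

    similar-extend₁ : Similar (suc T) ρ η ρ′ η′ → ∀ a → ∃ λ b → Similar T (extend a ρ) η (extend b ρ′) η′
    similar-extend₁ (similar sim) a with to (sim (profile ρ η a) (s≤s z≤n)) (atLeast-one refl)
    ... | b ∷ _ , _ , b-profile ∷ _ , _ = b , similar λ { (β ∷ e , c) →
      ≈-resp (≐-sym extended) (≐-sym extended) (≈-⁅⁆ (sim (e , c)) (mk⇔ (trans b-profile) (trans (sym b-profile))) β) }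
      where
      extended : ∀ {C} {ϱ : Fin n → C} {ϑ : Fin m → Subset C} {z β e c} →
                 profile (extend z ϱ) ϑ ⁻¹ (β ∷ e , c) ≐ profile ϱ ϑ ⁻¹ (e , c) ∩ ⁅ z ⁆ ⁻¹ β
      extended = (λ { refl → refl , refl }) , (λ { (refl , refl) → refl })

    similar-extend₂ : Similar (T + T) ρ η ρ′ η′ → ∀ X → ∃ λ Y → Similar T ρ (extend X η) ρ′ (extend Y η′)
    similar-extend₂ {T = T} (similar sim) X = Y , similar λ { (e , β ∷ c) →
      ≈-resp (≐-sym extendedˡ) (≐-sym extendedʳ) (proj₂ (split {T = T} (sim (e , c)) X) β) }
      where
      Z : Profile n m → Subset B
      Z t = proj₁ (split {T = T} (sim t) X)
      Y : Subset B
      Y y = Z (profile ρ′ η′ y) y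
      extendedˡ : ∀ {e β c} → profile ρ (extend X η) ⁻¹ (e , β ∷ c) ≐ profile ρ η ⁻¹ (e , c) ∩ X ⁻¹ β
      extendedˡ = (λ { refl → refl , refl }) , (λ { (refl , refl) → refl })
      extendedʳ : ∀ {e β c} → profile ρ′ (extend Y η′) ⁻¹ (e , β ∷ c) ≐ profile ρ′ η′ ⁻¹ (e , c) ∩ Z (e , c) ⁻¹ β
      extendedʳ = (λ { refl → refl , refl }) , (λ { (refl , refl) → refl })

  -- a point uses up one element of its class and a set halves the threshold, hence 2 ^ k
  pureSets : BackAndForth full (PureSet A) (PureSet B)
  pureSets = record
    { Related       = λ k → Similar (2 ^ k)
    ; related⇒atom  = λ _ ()
    ; related⇒equal = λ {k} → similar⇒equal (1≤2^ k)
    ; related⇒mem   = λ {k} → similar⇒mem (1≤2^ k)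
    ; forth₁        = λ {k} sim → similar-extend₁ (similar-≤ (1+2^≤2^suc k) sim)
    ; back₁         = λ {k} sim b →
                        let (a , sim′) = similar-extend₁ (similar-≤ (1+2^≤2^suc k) (similar-sym sim)) b
                        in a , similar-sym sim′
    ; forth₂        = λ {k} sim (X , _) →
                        let (Y , sim′) = similar-extend₂ (similar-≤ (2^+2^≤2^suc k) sim) X
                        in (Y , tt) , sim′
    ; back₂         = λ {k} sim (Y , _) →
                        let (X , sim′) = similar-extend₂ (similar-≤ (2^+2^≤2^suc k) (similar-sym sim)) Y
                        in (X , tt) , similar-sym sim′
    }
    where
    1≤2^ : ∀ k → 1 ≤ 2 ^ k
    1≤2^ k = m^n>0 2 k
    2^+2^≤2^suc : ∀ k → 2 ^ k + 2 ^ k ≤ 2 ^ suc k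
    2^+2^≤2^suc k = ≤-reflexive (cong (2 ^ k +_) (sym (+-identityʳ (2 ^ k))))
    1+2^≤2^suc : ∀ k → suc (2 ^ k) ≤ 2 ^ suc k
    1+2^≤2^suc k = ≤-trans (+-monoˡ-≤ (2 ^ k) (1≤2^ k)) (2^+2^≤2^suc k)

  pureSets-agree : (φ : Sentence []) → U {A = A} ≈[ 2 ^ quantifierRank φ ] U {A = B} →
                   Models full (PureSet A) φ ⇔ Models full (PureSet B) φ
  pureSets-agree φ A≈B = BackAndForth.models-transfer pureSets φ
    (similar λ { ([] , []) → ≈-resp everything everything A≈B })
    where
    everything : ∀ {C : Set} → U ≐ profile {A = C} noVars noVars ⁻¹ ([] , [])
    everything = (λ _ → refl) , (λ _ → tt)

  infiniteDomain-not-MSO : (ψ : Sentence []) →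
                           ¬ (∀ M → Models weak M infiniteDomain ⇔ Models full M ψ)
  infiniteDomain-not-MSO ψ defines = finite⇒¬infiniteDomain (allFin N) ∈-allFin
    (from (defines (PureSet (Fin N))) (to (pureSets-agree ψ (U-ℕ≈U-Fin N))
      (to (defines (PureSet ℕ)) (infinite⇒infiniteDomain infinite-ℕ))))
    where N = 2 ^ quantifierRank ψ

  -- WMSO on grids

  Grid : Set → Set → Structure GridVocabulary
  Grid R C = record { Carrier = R × C ; rel = sameLine }
    where
    sameLine : (S : RelSym GridVocabulary) → Vec (R × C) (arity GridVocabulary S) → Bool
    sameLine zero       (x ∷ y ∷ []) = does (proj₁ x ≟ proj₁ y)
    sameLine (suc zero) (x ∷ y ∷ []) = does (proj₂ x ≟ proj₂ y)

  isPartialBijection-cover : ∀ {π : List (A × B)} → Infinite B → IsPartialBijection π → (as : List A) →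
                             Σ[ π′ ∈ List (A × B) ] IsPartialBijection π′ × π ⊆ˡ π′ × All (Dom π′) as
  isPartialBijection-cover infinite bij [] = _ , bij , id , []
  isPartialBijection-cover infinite bij (a ∷ as) with isPartialBijection-cover infinite bij as
  ... | π′ , bij′ , π⊆π′ , covered with lem {Dom π′ a}
  ...   | yes a∈dom = π′ , bij′ , π⊆π′ , a∈dom ∷ covered
  ...   | no a∉dom with b , b∉ ← infinite (List.map proj₂ π′) =
    (a , b) ∷ π′ , isPartialBijection-∷ bij′ a∉dom (λ (_ , p∈) → b∉ (∈-map⁺ proj₂ p∈)) ,
    there ∘ π⊆π′ , (b , here refl) ∷ All.map (λ (b′ , p∈) → b′ , there p∈) covered

  isPartialBijection-⊆ : ∀ {π π′ : List (A × B)} {a b} → IsPartialBijection π′ → π ⊆ˡ π′ → (a , b) ∈ π′ →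
                         (a , b) ∈ π ⊎ (¬ Dom π a × ¬ Rng π b)
  isPartialBijection-⊆ {π = π} {a = a} {b} bij′ π⊆π′ p∈ with lem {Dom π a} | lem {Rng π b}
  ... | yes (b₀ , p₀∈) | _ = inj₁ (subst (λ b₁ → (a , b₁) ∈ π) (to (bij′ (π⊆π′ p₀∈) p∈) refl) p₀∈)
  ... | no a∉ | yes (a₀ , p₀∈) = ⊥-elim (a∉ (b , subst (λ a₁ → (a₁ , b) ∈ π) (from (bij′ (π⊆π′ p₀∈) p∈) refl) p₀∈))
  ... | no a∉ | no b∉ = inj₂ (a∉ , b∉)

  module _ {R₁ C₁ R₂ C₂ : Set} {ρ : Fin n → R₁ × C₁} {η : Fin m → Subset (R₁ × C₁)}
           {ρ′ : Fin n → R₂ × C₂} {η′ : Fin m → Subset (R₂ × C₂)} where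

    -- new row or column pairs meet no set, so the sets still agree on the enlarged subgrid
    matching-enlarge : (M : Matching ρ η ρ′ η′) → ∀ {PR PC} → IsPartialBijection PR → IsPartialBijection PC →
                       rowPairs M ⊆ˡ PR → columnPairs M ⊆ˡ PC → Matching ρ η ρ′ η′
    matching-enlarge M {PR} {PC} rows′ columns′ PR⊆ PC⊆ = record
      { rowPairs    = PR
      ; columnPairs = PC
      ; rows        = rows′
      ; columns     = columns′
      ; points      = λ i → let (r , c) = points M i in PR⊆ r , PC⊆ c
      ; sets        = sets′
      ; supportˡ    = λ X a∈X → let ((_ , r) , (_ , c)) = supportˡ M X a∈X in (_ , PR⊆ r) , (_ , PC⊆ c)
      ; supportʳ    = λ X b∈X → let ((_ , r) , (_ , c)) = supportʳ M X b∈X in (_ , PR⊆ r) , (_ , PC⊆ c)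
      }
      where
      sets′ : ∀ X {a b} → Corresponds PR PC a b → η X a ≡ η′ X b
      sets′ X (r , c) with isPartialBijection-⊆ rows′ PR⊆ r | isPartialBijection-⊆ columns′ PC⊆ c
      ... | inj₁ r-old | inj₁ c-old = sets M X (r-old , c-old)
      ... | inj₂ (a∉ , b∉) | _ = trans (¬-not (a∉ ∘ proj₁ ∘ supportˡ M X)) (sym (¬-not (b∉ ∘ proj₁ ∘ supportʳ M X)))
      ... | inj₁ _ | inj₂ (a∉ , b∉) = trans (¬-not (a∉ ∘ proj₂ ∘ supportˡ M X)) (sym (¬-not (b∉ ∘ proj₂ ∘ supportʳ M X)))

    matching-cover : Infinite R₂ → Infinite C₂ → Matching ρ η ρ′ η′ → (as : List (R₁ × C₁)) →
                     Σ[ M ∈ Matching ρ η ρ′ η′ ] All (λ a → Dom (rowPairs M) (proj₁ a) × Dom (columnPairs M) (proj₂ a)) as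
    matching-cover infiniteR infiniteC M as
      with isPartialBijection-cover infiniteR (rows M) (List.map proj₁ as)
         | isPartialBijection-cover infiniteC (columns M) (List.map proj₂ as)
    ... | PR , rows′ , PR⊆ , rowsCovered | PC , columns′ , PC⊆ , columnsCovered =
      matching-enlarge M rows′ columns′ PR⊆ PC⊆ , All.zip (Allₚ.map⁻ rowsCovered , Allₚ.map⁻ columnsCovered)

    matching-∷ : (M : Matching ρ η ρ′ η′) → ∀ {a b} → Corresponds (rowPairs M) (columnPairs M) a b →
                 Matching (extend a ρ) η (extend b ρ′) η′
    matching-∷ M a∼b = record
      { rowPairs    = rowPairs M
      ; columnPairs = columnPairs M
      ; rows        = rows M
      ; columns     = columns M
      ; points      = λ { zero → a∼b ; (suc i) → points M i }
      ; sets        = sets M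
      ; supportˡ    = supportˡ M
      ; supportʳ    = supportʳ M
      }

    matching-extend₁ : Infinite R₂ → Infinite C₂ → Matching ρ η ρ′ η′ →
                       ∀ a → ∃ λ b → Matching (extend a ρ) η (extend b ρ′) η′
    matching-extend₁ infiniteR infiniteC M a with matching-cover infiniteR infiniteC M (a ∷ [])
    ... | M′ , ((r′ , r) , (c′ , c)) ∷ [] = (r′ , c′) , matching-∷ M′ (r , c)

    matching-extend₂ : Infinite R₂ → Infinite C₂ → Matching ρ η ρ′ η′ →
                       ∀ (X : AdmissibleSubset weak (R₁ × C₁)) → ∃ λ (Y : AdmissibleSubset weak (R₂ × C₂)) →
                       Matching ρ (extend (proj₁ X) η) ρ′ (extend (proj₁ Y) η′)
    matching-extend₂ infiniteR infiniteC M (X , xs , X⊆xs) with matching-cover infiniteR infiniteC M xs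
    ... | M′ , covered = (Y , Y-finite) , record
      { rowPairs    = rowPairs M′
      ; columnPairs = columnPairs M′
      ; rows        = rows M′
      ; columns     = columns M′
      ; points      = points M′
      ; sets        = λ { zero → X≡Y ; (suc X′) → sets M′ X′ }
      ; supportˡ    = λ { zero a∈X → All.lookup covered (X⊆xs _ a∈X) ; (suc X′) → supportˡ M′ X′ }
      ; supportʳ    = λ { zero b∈Y → let (a , (r , c) , _) = to (does⇔ lem) b∈Y in (_ , r) , (_ , c)
                        ; (suc X′) → supportʳ M′ X′ }
      }
      where
      _∼_ = Corresponds (rowPairs M′) (columnPairs M′)

      Y : Subset (R₂ × C₂)
      Y b = does (lem {∃ λ a → a ∼ b × X a ≡ true})

      Y-finite : Finite Y
      Y-finite = List.cartesianProduct (List.map proj₂ (rowPairs M′)) (List.map proj₂ (columnPairs M′)) ,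
                 λ b b∈Y → let (_ , (r , c) , _) = to (does⇔ lem) b∈Y in ∈-cartesianProduct⁺ (∈-map⁺ proj₂ r) (∈-map⁺ proj₂ c)

      ∼-injective : ∀ {a a′ b} → a ∼ b → a′ ∼ b → a ≡ a′
      ∼-injective (r , c) (r′ , c′) = ×-≡,≡→≡ (from (rows M′ r r′) refl , from (columns M′ c c′) refl)

      X≡Y : ∀ {a b} → a ∼ b → X a ≡ Y b
      X≡Y {a} a∼b = true⇔true⇒≡ (mk⇔ (λ a∈X → dec-true lem (a , a∼b , a∈X))
        (λ b∈Y → let (a′ , a′∼b , a′∈X) = to (does⇔ lem) b∈Y in subst (λ x → X x ≡ true) (∼-injective a′∼b a∼b) a′∈X))

    matching⇒equal : Matching ρ η ρ′ η′ → ∀ i j → (ρ i ≡ ρ j) ⇔ (ρ′ i ≡ ρ′ j)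
    matching⇒equal M i j = ⇔.trans (⇔.sym (↔⇒⇔ ×-≡,≡↔≡)) (⇔.trans
      (rows M (proj₁ (points M i)) (proj₁ (points M j)) ×-⇔ columns M (proj₂ (points M i)) (proj₂ (points M j)))
      (↔⇒⇔ ×-≡,≡↔≡))

  grids : ∀ {R₁ C₁ R₂ C₂} → Infinite R₁ → Infinite C₁ → Infinite R₂ → Infinite C₂ →
          BackAndForth weak (Grid R₁ C₁) (Grid R₂ C₂)
  grids infiniteR₁ infiniteC₁ infiniteR₂ infiniteC₂ = record
    { Related       = λ _ → Matching
    ; related⇒atom  = matching⇒sameLine
    ; related⇒equal = matching⇒equal
    ; related⇒mem   = λ M i X → ≡-true⇔ (sets M X (points M i))
    ; forth₁        = matching-extend₁ infiniteR₂ infiniteC₂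
    ; back₁         = λ M b → let (a , M′) = matching-extend₁ infiniteR₁ infiniteC₁ (matching-swap M) b
                              in a , matching-swap M′
    ; forth₂        = matching-extend₂ infiniteR₂ infiniteC₂
    ; back₂         = λ M Y → let (X , M′) = matching-extend₂ infiniteR₁ infiniteC₁ (matching-swap M) Y
                              in X , matching-swap M′
    }
    where
    matching⇒sameLine : ∀ {n m ρ η ρ′ η′} → Matching {n = n} {m} ρ η ρ′ η′ → ∀ R xs →
           (rel (Grid _ _) R (Vec.map ρ xs) ≡ true) ⇔ (rel (Grid _ _) R (Vec.map ρ′ xs) ≡ true)
    matching⇒sameLine M zero (i ∷ j ∷ []) =
      ⇔.trans (does⇔ lem) (⇔.trans (rows M (proj₁ (points M i)) (proj₁ (points M j))) (⇔.sym (does⇔ lem)))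
    matching⇒sameLine M (suc zero) (i ∷ j ∷ []) =
      ⇔.trans (does⇔ lem) (⇔.trans (columns M (proj₂ (points M i)) (proj₂ (points M j))) (⇔.sym (does⇔ lem)))

  grids-agree : ∀ {R₁ C₁ R₂ C₂} → Infinite R₁ → Infinite C₁ → Infinite R₂ → Infinite C₂ →
                (φ : Sentence GridVocabulary) → Models weak (Grid R₁ C₁) φ ⇔ Models weak (Grid R₂ C₂) φ
  grids-agree infiniteR₁ infiniteC₁ infiniteR₂ infiniteC₂ φ =
    BackAndForth.models-transfer (grids infiniteR₁ infiniteC₁ infiniteR₂ infiniteC₂) φ record
      { rowPairs = [] ; columnPairs = [] ; rows = λ () ; columns = λ () ; points = λ ()
      ; sets = λ () ; supportˡ = λ () ; supportʳ = λ () }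

  cantor : Models full (Grid ℕ (ℕ → Bool)) noSurjection
  -- with column r the column of the X-point in row r, the X-point y in column diagonal column
  -- shares its row with the X-point x, so column (proj₁ y) ≡ diagonal column
  cantor X (total , onto , functional) =
    [ (λ ¬sameRow → ¬sameRow (x∈X , y∈X , dec-true lem x-row))
    , (λ sameColumn′ → diagonal-≢ column (proj₁ y) (trans (to (does⇔ lem) sameColumn′) y-column))
    ] (functional x y)
    where
    column : ℕ → ℕ → Bool
    column r = proj₂ (proj₁ (total (r , λ _ → false)))
    y = proj₁ (onto (0 , diagonal column))
    y∈X = proj₁ (proj₂ (onto (0 , diagonal column)))
    y-column = to (does⇔ lem) (proj₂ (proj₂ (onto (0 , diagonal column))))
    x = proj₁ (total (proj₁ y , λ _ → false))
    x∈X = proj₁ (proj₂ (total (proj₁ y , λ _ → false)))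
    x-row = to (does⇔ lem) (proj₂ (proj₂ (total (proj₁ y , λ _ → false))))

  ¬noSurjection-ℕ×ℕ : ¬ Models full (Grid ℕ ℕ) noSurjection
  ¬noSurjection-ℕ×ℕ holds = holds diagonalSet
    ( (λ (r , _) → (r , r) , dec-true lem refl , dec-true lem refl)
    , (λ (_ , c) → (c , c) , dec-true lem refl , dec-true lem refl)
    , functional)
    where
    diagonalSet : Subset (ℕ × ℕ)
    diagonalSet (r , c) = does (r ≟ c)
    functional : ∀ a b → ¬ (diagonalSet a ≡ true × diagonalSet b ≡ true × does (proj₁ a ≟ proj₁ b) ≡ true)
                         ⊎ does (proj₂ a ≟ proj₂ b) ≡ true
    functional (r , c) (r′ , c′) with c ≟ c′
    ... | yes _ = inj₂ refl
    ... | no c≢c′ = inj₁ λ (a∈X , b∈X , sameRow′) →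
      c≢c′ (trans (sym (to (does⇔ lem) a∈X)) (trans (to (does⇔ lem) sameRow′) (to (does⇔ lem) b∈X)))

  noSurjection-not-WMSO : (ψ : Sentence GridVocabulary) →
                          ¬ (∀ M → Models full M noSurjection ⇔ Models weak M ψ)
  noSurjection-not-WMSO ψ defines = ¬noSurjection-ℕ×ℕ (from (defines (Grid ℕ ℕ))
    (to (grids-agree infinite-ℕ infinite-ℕ→Bool infinite-ℕ infinite-ℕ ψ)
      (to (defines (Grid ℕ (ℕ → Bool))) cantor)))

proposition3p1 : ExcludedMiddle 0ℓ → (¬ (∀WMSO ≤L MSO)) × (¬ (∀MSO ≤L WMSO))
proposition3p1 lem = ∀WMSO≰MSO , ∀MSO≰WMSO
  where
  ∀WMSO≰MSO : ¬ (∀WMSO ≤L MSO)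
  ∀WMSO≰MSO ∀WMSO≤MSO = let (ψ , _ , defines) = ∀WMSO≤MSO [] infiniteDomain infiniteDomain-universal
                        in infiniteDomain-not-MSO lem ψ defines
  ∀MSO≰WMSO : ¬ (∀MSO ≤L WMSO)
  ∀MSO≰WMSO ∀MSO≤WMSO = let (ψ , _ , defines) = ∀MSO≤WMSO GridVocabulary noSurjection noSurjection-universal
                        in noSurjection-not-WMSO lem ψ defines
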